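{- Let $a,b,c,d$ be integers and let $x$ be a number such that $\Delta_1 = 1-L_{b+d}x+(-1)^{b+d}x^2$ and $\Delta_2 = 1-(-1)^dL_{b-d}x+(-1)^{b-d}x^2$ are both nonzero. For integers $v\ge 1$ and $w$ define $$P_2(v,w)=\sum_{k=0}^{v}\binom{v}{k}(-1)^{(b+d+1)k}x^k\,G_{a+bw-bk}H_{c+dw-dk},$$ let $P_2^-(v,w)$ (resp. $P_2^+(v,w)$) be the same expression with $a,c$ replaced by $a-1,c-1$ (resp. $a+1,c+1$), and $$Q_2(v,w)=\frac15\Big[\Big(\frac{2}{\Delta_1^v}+\frac{3}{\Delta_2^v}\Big)P_2(v,w)+\Big(\frac{1}{\Delta_1^v}-\frac{1}{\Delta_2^v}\Big)\big(P_2^-(v,w)+P_2^+(v,w)\big)\Big].$$ Then for every integer $n\ge 0$, $$\sum_{k=0}^n x^kG_{a+bk}H_{c+dk}=-x^{n+1}Q_2(1,n+1)+Q_2(1,0).$$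
   Context: $(G_n)_{n\in\mathbb Z}$ and $(H_n)_{n\in\mathbb Z}$ are generalized Fibonacci sequences: $G_{n+2}=G_{n+1}+G_n$ and $H_{n+2}=H_{n+1}+H_n$ for all integers $n$, with arbitrary initial values $G_0,G_1$ and $H_0,H_1$ (extended to negative indices by the recurrence). $L_n$ denotes the Lucas numbers ($L_0=2$, $L_1=1$, $L_{n+2}=L_{n+1}+L_n$ for all integers $n$). -}

module Defs where

open import Level using (Level; _⊔_) renaming (suc to lsuc)
open import Algebra.Bundles using (CommutativeRing)
open import Data.Nat as ℕ using (ℕ; zero; suc)
open import Data.Nat.Combinatorics using (_C_)
open import Data.Integer as ℤ using (ℤ; +_; -[1+_])
open import Data.Product using (Σ; _×_; _,_; proj₁; proj₂)
open import Relation.Nullary using (¬_)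

-- A field of characteristic zero ("x is a number": the paper works over ℝ or ℂ;
-- we work over an arbitrary field of characteristic 0, which includes both).
-- embedding of natural numbers into a ring: n ↦ 1 + 1 + ... + 1
ringFromℕ : ∀ {c ℓ} (R : CommutativeRing c ℓ) → ℕ → CommutativeRing.Carrier R
ringFromℕ R zero    = CommutativeRing.0# R
ringFromℕ R (suc n) = CommutativeRing._+_ R (CommutativeRing.1# R) (ringFromℕ R n)

record Char0Field (c ℓ : Level) : Set (lsuc (c ⊔ ℓ)) where
  field
    commutativeRing : CommutativeRing c ℓ
  open CommutativeRing commutativeRing public
  fromℕ : ℕ → Carrier
  fromℕ = ringFromℕ commutativeRing
  field
    1≉0      : ¬ (1# ≈ 0#)
    inverse  : ∀ y → ¬ (y ≈ 0#) → Σ Carrier (λ z → y * z ≈ 1#)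
    char0    : ∀ n → ¬ (fromℕ (suc n) ≈ 0#)

-- Lucas numbers on all integers, extended to negative indices by the recurrence.
-- lucasFwd n = (L n , L (n+1));  lucasBwd n = (L (-n) , L (-n+1))
lucasFwd : ℕ → ℤ × ℤ
lucasFwd zero    = (+ 2 , + 1)
lucasFwd (suc n) with lucasFwd n
... | (p , q) = (q , p ℤ.+ q)

lucasBwd : ℕ → ℤ × ℤ
lucasBwd zero    = (+ 2 , + 1)
lucasBwd (suc n) with lucasBwd n
... | (p , q) = (q ℤ.- p , p)

Lucas : ℤ → ℤ
Lucas (+ n)      = proj₁ (lucasFwd n)
Lucas -[1+ n ]   = proj₁ (lucasBwd (suc n))

module _ {c ℓ} (F : Char0Field c ℓ) where
  open Char0Field F

  pow : Carrier → ℕ → Carrier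
  pow y zero    = 1#
  pow y (suc n) = y * pow y n

  fromℤ : ℤ → Carrier
  fromℤ (+ n)    = fromℕ n
  fromℤ -[1+ n ] = - fromℕ (suc n)

  sign : ℤ → Carrier
  sign m = pow (- 1#) ℤ.∣ m ∣

  sumTo : ℕ → (ℕ → Carrier) → Carrier
  sumTo zero    f = f 0
  sumTo (suc n) f = sumTo n f + f (suc n)

  IsGenFib : (ℤ → Carrier) → Set ℓ
  IsGenFib G = ∀ n → G (n ℤ.+ + 2) ≈ G (n ℤ.+ + 1) + G n

  Δ₁ : (b d : ℤ) (x : Carrier) → Carrier
  Δ₁ b d x = 1# - fromℤ (Lucas (b ℤ.+ d)) * x + sign (b ℤ.+ d) * (x * x)

  Δ₂ : (b d : ℤ) (x : Carrier) → Carrier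
  Δ₂ b d x = 1# - sign d * fromℤ (Lucas (b ℤ.- d)) * x + sign (b ℤ.- d) * (x * x)

  -- P₂(v,w) with a, c as parameters (so P₂⁻ / P₂⁺ are P₂ at a-1,c-1 / a+1,c+1)
  P₂ : (G H : ℤ → Carrier) (a b c d : ℤ) (x : Carrier) (v : ℕ) (w : ℤ) → Carrier
  P₂ G H a b c d x v w =
    sumTo v (λ k → fromℕ (v C k) * sign ((b ℤ.+ d ℤ.+ + 1) ℤ.* + k) * pow x k
                   * G (a ℤ.+ b ℤ.* w ℤ.- b ℤ.* + k)
                   * H (c ℤ.+ d ℤ.* w ℤ.- d ℤ.* + k))

  -- Q₂(v,w), given the (unique) inverses i₁ = 1/Δ₁, i₂ = 1/Δ₂, i₅ = 1/5
  Q₂ : (G H : ℤ → Carrier) (a b c d : ℤ) (x : Carrier)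
       (i₁ i₂ i₅ : Carrier) (v : ℕ) (w : ℤ) → Carrier
  Q₂ G H a b c d x i₁ i₂ i₅ v w =
    i₅ * ( (fromℕ 2 * pow i₁ v + fromℕ 3 * pow i₂ v) * P₂ G H a b c d x v w
         + (pow i₁ v - pow i₂ v)
           * ( P₂ G H (a ℤ.- + 1) b (c ℤ.- + 1) d x v w
             + P₂ G H (a ℤ.+ + 1) b (c ℤ.+ + 1) d x v w))

  inv : (y : Carrier) → ¬ (y ≈ 0#) → Carrier
  inv y p = proj₁ (inverse y p)

-- Put g A C = G_A H_C and, along the points (A, C) = (a + bw, c + dw), the pairs
-- p u w = u A C - (-1)^(b+d) x u (A - b) (C - d), so that 5 Q₂(1,w) = p T w / Δ₁ + p U w / Δ₂ with
-- T = 2g + g(A-1,C-1) + g(A+1,C+1) and U = 3g - g(A-1,C-1) - g(A+1,C+1); note T + U = 5g.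
-- Moving (A, C) by (b, d) acts on T as a shift by b + d of a generalized Fibonacci sequence and on U
-- as (-1)^d times a shift by b - d, so the identity t(N+k) + (-1)^k t(N-k) = L_k t(N) gives
-- p T w = x p T (w+1) + Δ₁ T and p U w = x p U (w+1) + Δ₂ U.  Hence Q₂(1,w) = x Q₂(1,w+1) + g A C,
-- and the sum telescopes.  Identities between generalized Fibonacci sequences are all proved by
-- comparing two consecutive values.
module Submission where

open import Defs
open import Algebra.Solver.Ring.AlmostCommutativeRing
  using (_-Raw-AlmostCommutative⟶_; fromCommutativeRing)
open import Data.Integer using (ℤ; +_; -[1+_]; _⊖_; 0ℤ; 1ℤ)
import Data.Integer as ℤ
import Data.Integer.Properties as ℤ
open import Data.Integer.Tactic.RingSolver using () renaming (solve to solveℤ; solve-∀ to solve-∀ℤ)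
open import Data.List.Base using (_∷_; [])
open import Data.Maybe.Base using (Maybe; just; nothing)
open import Data.Nat as ℕ using (ℕ; zero; suc)
import Data.Nat.Properties as ℕ
open import Data.Product using (_×_; _,_; proj₁; proj₂)
open import Relation.Binary.PropositionalEquality as ≡ using (_≡_)
open import Relation.Nullary using (¬_)
open import Relation.Nullary.Decidable using (yes; no)

ℤ-induction : ∀ {p} (P : ℤ → Set p) → P 0ℤ →
              (∀ i → P i → P (i ℤ.+ 1ℤ)) → (∀ i → P (i ℤ.+ 1ℤ) → P i) → ∀ i → P i
ℤ-induction P base up down = go
  where
  go : ∀ i → P i
  go (+ zero)       = base
  go (+ suc n)      = ≡.subst P (≡.cong +_ (ℕ.+-comm n 1)) (up (+ n) (go (+ n)))
  go -[1+ zero ]    = down -[1+ zero ] base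
  go -[1+ suc n ]   = down -[1+ suc n ] (go -[1+ n ])

lucas-recurrence : ∀ n → Lucas (n ℤ.+ + 2) ≡ Lucas (n ℤ.+ + 1) ℤ.+ Lucas n
lucas-recurrence (+ n) rewrite ℕ.+-comm n 2 | ℕ.+-comm n 1 =
  ℤ.+-comm (proj₁ (lucasFwd n)) (proj₂ (lucasFwd n))
lucas-recurrence -[1+ 0 ]           = ≡.refl
lucas-recurrence -[1+ 1 ]           = ≡.refl
lucas-recurrence -[1+ suc (suc n) ] = backwards (proj₁ (lucasBwd n)) (proj₂ (lucasBwd n))
  where
  backwards : ∀ p q → q ℤ.- p ≡ (p ℤ.- (q ℤ.- p)) ℤ.+ ((q ℤ.- p) ℤ.- (p ℤ.- (q ℤ.- p)))
  backwards = solve-∀ℤ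

[i+1]-1≡i : ∀ i → i ℤ.+ 1ℤ ℤ.- 1ℤ ≡ i
[i+1]-1≡i = solve-∀ℤ

[i-1]+1≡i : ∀ i → i ℤ.- 1ℤ ℤ.+ 1ℤ ≡ i
[i-1]+1≡i = solve-∀ℤ

i-j*0≡i : ∀ i j → i ℤ.- j ℤ.* 0ℤ ≡ i
i-j*0≡i = solve-∀ℤ

i-j*1≡i-j : ∀ i j → i ℤ.- j ℤ.* 1ℤ ≡ i ℤ.- j
i-j*1≡i-j = solve-∀ℤ

[i+e]+j*w≡[i+j*w]+e : ∀ i e j w → i ℤ.+ e ℤ.+ j ℤ.* w ≡ i ℤ.+ j ℤ.* w ℤ.+ e
[i+e]+j*w≡[i+j*w]+e = solve-∀ℤ

[i+e]+j*w-j≡[i+j*w-j]+e : ∀ i e j w → i ℤ.+ e ℤ.+ j ℤ.* w ℤ.- j ≡ i ℤ.+ j ℤ.* w ℤ.- j ℤ.+ e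
[i+e]+j*w-j≡[i+j*w-j]+e = solve-∀ℤ

i+j*[w+1]≡i+j*w+j : ∀ i j w → i ℤ.+ j ℤ.* (w ℤ.+ 1ℤ) ≡ i ℤ.+ j ℤ.* w ℤ.+ j
i+j*[w+1]≡i+j*w+j = solve-∀ℤ

i+j*[w+1]-j≡i+j*w : ∀ i j w → i ℤ.+ j ℤ.* (w ℤ.+ 1ℤ) ℤ.- j ≡ i ℤ.+ j ℤ.* w
i+j*[w+1]-j≡i+j*w = solve-∀ℤ

module _ {r ℓ} (F : Char0Field r ℓ) where
  open Char0Field F
  open import Algebra.Definitions _≈_ using (Congruent₂)
  open import Algebra.Properties.Ring ring
    using (-‿involutive; -0#≈0#; -‿+-comm; -‿distribʳ-*; -‿distribˡ-*; -1*x≈-x; +-cancelˡ)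
  open import Algebra.Properties.CommutativeSemigroup +-commutativeSemigroup using (interchange)
  open import Algebra.Properties.Semiring.Mult semiring using (×-homo-+; ×1-homo-*)
    renaming (_×_ to _times_)
  open import Relation.Binary.Reasoning.Setoid setoid

  reindex : (t : ℤ → Carrier) {i j : ℤ} → i ≡ j → t i ≈ t j
  reindex t i≡j = reflexive (≡.cong t i≡j)

  reindex₂ : (u : ℤ → ℤ → Carrier) {i i′ j j′ : ℤ} → i ≡ i′ → j ≡ j′ → u i j ≈ u i′ j′
  reindex₂ u i≡i′ j≡j′ = reflexive (≡.cong₂ u i≡i′ j≡j′)

  fromℕ≈×1# : ∀ n → fromℕ n ≈ n times 1#
  fromℕ≈×1# zero    = refl
  fromℕ≈×1# (suc n) = +-congˡ (fromℕ≈×1# n)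

  fromℕ-+ : ∀ m n → fromℕ (m ℕ.+ n) ≈ fromℕ m + fromℕ n
  fromℕ-+ m n = begin
    fromℕ (m ℕ.+ n)           ≈⟨ fromℕ≈×1# (m ℕ.+ n) ⟩
    (m ℕ.+ n) times 1#        ≈⟨ ×-homo-+ 1# m n ⟩
    m times 1# + n times 1#   ≈⟨ +-cong (fromℕ≈×1# m) (fromℕ≈×1# n) ⟨
    fromℕ m + fromℕ n         ∎

  fromℕ-* : ∀ m n → fromℕ (m ℕ.* n) ≈ fromℕ m * fromℕ n
  fromℕ-* m n = begin
    fromℕ (m ℕ.* n)             ≈⟨ fromℕ≈×1# (m ℕ.* n) ⟩
    (m ℕ.* n) times 1#          ≈⟨ ×1-homo-* m n ⟩
    m times 1# * (n times 1#)   ≈⟨ *-cong (fromℕ≈×1# m) (fromℕ≈×1# n) ⟨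
    fromℕ m * fromℕ n           ∎

  fromℤ-neg : ∀ i → fromℤ F (ℤ.- i) ≈ - fromℤ F i
  fromℤ-neg (+ zero)  = sym -0#≈0#
  fromℤ-neg (+ suc n) = refl
  fromℤ-neg -[1+ n ]  = sym (-‿involutive _)

  [x+y]-[x+z]≈y-z : ∀ x y z → (x + y) - (x + z) ≈ y - z
  [x+y]-[x+z]≈y-z x y z = begin
    (x + y) - (x + z)       ≈⟨ +-congˡ (-‿+-comm x z) ⟨
    (x + y) + (- x + - z)   ≈⟨ interchange x y (- x) (- z) ⟩
    (x - x) + (y - z)       ≈⟨ +-congʳ (-‿inverseʳ x) ⟩
    0# + (y - z)            ≈⟨ +-identityˡ _ ⟩
    y - z                   ∎

  fromℤ-⊖ : ∀ m n → fromℤ F (m ⊖ n) ≈ fromℕ m - fromℕ n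
  fromℤ-⊖ zero    zero    = sym (-‿inverseʳ 0#)
  fromℤ-⊖ zero    (suc n) = sym (+-identityˡ _)
  fromℤ-⊖ (suc m) zero    = sym (trans (+-congˡ -0#≈0#) (+-identityʳ _))
  fromℤ-⊖ (suc m) (suc n) = begin
    fromℤ F (suc m ⊖ suc n)           ≡⟨ ≡.cong (fromℤ F) (ℤ.[1+m]⊖[1+n]≡m⊖n m n) ⟩
    fromℤ F (m ⊖ n)                   ≈⟨ fromℤ-⊖ m n ⟩
    fromℕ m - fromℕ n                 ≈⟨ [x+y]-[x+z]≈y-z 1# (fromℕ m) (fromℕ n) ⟨
    (1# + fromℕ m) - (1# + fromℕ n)   ∎

  fromℤ-+ : ∀ i j → fromℤ F (i ℤ.+ j) ≈ fromℤ F i + fromℤ F j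
  fromℤ-+ -[1+ m ] -[1+ n ] = begin
    - fromℕ (suc (suc (m ℕ.+ n)))       ≡⟨ ≡.cong (λ k → - fromℕ (suc k)) (ℕ.+-suc m n) ⟨
    - fromℕ (suc m ℕ.+ suc n)           ≈⟨ -‿cong (fromℕ-+ (suc m) (suc n)) ⟩
    - (fromℕ (suc m) + fromℕ (suc n))   ≈⟨ -‿+-comm _ _ ⟨
    - fromℕ (suc m) + - fromℕ (suc n)   ∎
  fromℤ-+ -[1+ m ] (+ n)    = trans (fromℤ-⊖ n (suc m)) (+-comm _ _)
  fromℤ-+ (+ m)    -[1+ n ] = fromℤ-⊖ m (suc n)
  fromℤ-+ (+ m)    (+ n)    = fromℕ-+ m n

  fromℤ-*-+ : ∀ m j → fromℤ F (+ m ℤ.* j) ≈ fromℕ m * fromℤ F j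
  fromℤ-*-+ m (+ n)    = trans (reflexive (≡.cong (fromℤ F) (≡.sym (ℤ.pos-* m n)))) (fromℕ-* m n)
  fromℤ-*-+ m -[1+ n ] = begin
    fromℤ F (+ m ℤ.* ℤ.- + suc n)     ≡⟨ ≡.cong (fromℤ F) (ℤ.neg-distribʳ-* (+ m) (+ suc n)) ⟨
    fromℤ F (ℤ.- (+ m ℤ.* + suc n))   ≈⟨ fromℤ-neg (+ m ℤ.* + suc n) ⟩
    - fromℤ F (+ m ℤ.* + suc n)       ≈⟨ -‿cong (fromℤ-*-+ m (+ suc n)) ⟩
    - (fromℕ m * fromℕ (suc n))       ≈⟨ -‿distribʳ-* _ _ ⟩
    fromℕ m * - fromℕ (suc n)         ∎

  fromℤ-* : ∀ i j → fromℤ F (i ℤ.* j) ≈ fromℤ F i * fromℤ F j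
  fromℤ-* (+ m)    j = fromℤ-*-+ m j
  fromℤ-* -[1+ m ] j = begin
    fromℤ F (ℤ.- + suc m ℤ.* j)       ≡⟨ ≡.cong (fromℤ F) (ℤ.neg-distribˡ-* (+ suc m) j) ⟨
    fromℤ F (ℤ.- (+ suc m ℤ.* j))     ≈⟨ fromℤ-neg (+ suc m ℤ.* j) ⟩
    - fromℤ F (+ suc m ℤ.* j)         ≈⟨ -‿cong (fromℤ-*-+ (suc m) j) ⟩
    - (fromℕ (suc m) * fromℤ F j)     ≈⟨ -‿distribˡ-* _ _ ⟩
    - fromℕ (suc m) * fromℤ F j       ∎

  -- fromℤ (+ 1) is 1# + 0#; sending 1 to 1# itself lets solved identities mention 1# literally.
  coefficient : ℤ → Carrier
  coefficient (+ 1) = 1#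
  coefficient i     = fromℤ F i

  coefficient≈fromℤ : ∀ i → coefficient i ≈ fromℤ F i
  coefficient≈fromℤ (+ 0)           = refl
  coefficient≈fromℤ (+ 1)           = sym (+-identityʳ 1#)
  coefficient≈fromℤ (+ suc (suc n)) = refl
  coefficient≈fromℤ -[1+ n ]        = refl

  coefficient-homomorphism :
    ℤ.+-*-rawRing -Raw-AlmostCommutative⟶ fromCommutativeRing commutativeRing
  coefficient-homomorphism = record
    { ⟦_⟧    = coefficient
    ; +-homo = λ i j → homo₂ +-cong (i ℤ.+ j) i j (fromℤ-+ i j)
    ; *-homo = λ i j → homo₂ *-cong (i ℤ.* j) i j (fromℤ-* i j)
    ; -‿homo = λ i → trans (coefficient≈fromℤ (ℤ.- i))
                           (trans (fromℤ-neg i) (-‿cong (sym (coefficient≈fromℤ i))))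
    ; 0-homo = refl
    ; 1-homo = refl
    }
    where
    homo₂ : ∀ {_∙_} → Congruent₂ _∙_ → ∀ k i j →
            fromℤ F k ≈ fromℤ F i ∙ fromℤ F j → coefficient k ≈ coefficient i ∙ coefficient j
    homo₂ ∙-cong k i j k≈i∙j = trans (coefficient≈fromℤ k)
      (trans k≈i∙j (sym (∙-cong (coefficient≈fromℤ i) (coefficient≈fromℤ j))))

  coefficient-≟ : ∀ i j → Maybe (coefficient i ≈ coefficient j)
  coefficient-≟ i j with i ℤ.≟ j
  ... | yes ≡.refl = just refl
  ... | no _       = nothing

  open import Algebra.Solver.Ring ℤ.+-*-rawRing (fromCommutativeRing commutativeRing)
    coefficient-homomorphism coefficient-≟
    using (solve; _:=_; _:+_; _:-_; _:*_; :-_; con)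

  sign-suc : ∀ i → sign F (i ℤ.+ 1ℤ) ≈ - sign F i
  sign-suc (+ n)        = trans (reindex (sign F) (≡.cong +_ (ℕ.+-comm n 1))) (-1*x≈-x _)
  sign-suc -[1+ zero ]  = sym (trans (-‿cong (-1*x≈-x 1#)) (-‿involutive 1#))
  sign-suc -[1+ suc n ] = sym (trans (-‿cong (-1*x≈-x _)) (-‿involutive _))

  sign-pred : ∀ i → sign F i ≈ - sign F (i ℤ.+ 1ℤ)
  sign-pred i = trans (sym (-‿involutive _)) (-‿cong (sym (sign-suc i)))

  sign-+ : ∀ i j → sign F (i ℤ.+ j) ≈ sign F i * sign F j
  sign-+ i = ℤ-induction (λ j → sign F (i ℤ.+ j) ≈ sign F i * sign F j) base up down
    where
    base : sign F (i ℤ.+ 0ℤ) ≈ sign F i * 1#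
    base = trans (reindex (sign F) (ℤ.+-identityʳ i)) (sym (*-identityʳ _))
    up : ∀ j → sign F (i ℤ.+ j) ≈ sign F i * sign F j →
         sign F (i ℤ.+ (j ℤ.+ 1ℤ)) ≈ sign F i * sign F (j ℤ.+ 1ℤ)
    up j ih = begin
      sign F (i ℤ.+ (j ℤ.+ 1ℤ))      ≡⟨ ≡.cong (sign F) (ℤ.+-assoc i j 1ℤ) ⟨
      sign F (i ℤ.+ j ℤ.+ 1ℤ)        ≈⟨ sign-suc (i ℤ.+ j) ⟩
      - sign F (i ℤ.+ j)             ≈⟨ -‿cong ih ⟩
      - (sign F i * sign F j)        ≈⟨ -‿distribʳ-* _ _ ⟩
      sign F i * - sign F j          ≈⟨ *-congˡ (sign-suc j) ⟨
      sign F i * sign F (j ℤ.+ 1ℤ)   ∎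
    down : ∀ j → sign F (i ℤ.+ (j ℤ.+ 1ℤ)) ≈ sign F i * sign F (j ℤ.+ 1ℤ) →
           sign F (i ℤ.+ j) ≈ sign F i * sign F j
    down j ih = begin
      sign F (i ℤ.+ j)                   ≈⟨ sign-pred (i ℤ.+ j) ⟩
      - sign F (i ℤ.+ j ℤ.+ 1ℤ)          ≡⟨ ≡.cong (λ k → - sign F k) (ℤ.+-assoc i j 1ℤ) ⟩
      - sign F (i ℤ.+ (j ℤ.+ 1ℤ))        ≈⟨ -‿cong ih ⟩
      - (sign F i * sign F (j ℤ.+ 1ℤ))   ≈⟨ -‿distribʳ-* _ _ ⟩
      sign F i * - sign F (j ℤ.+ 1ℤ)     ≈⟨ *-congˡ (sign-pred j) ⟨
      sign F i * sign F j                ∎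

  sign-neg : ∀ i → sign F (ℤ.- i) ≈ sign F i
  sign-neg i = reflexive (≡.cong (pow F (- 1#)) (ℤ.∣-i∣≡∣i∣ i))

  sign[i+j]≈sign[i-j] : ∀ i j → sign F (i ℤ.+ j) ≈ sign F (i ℤ.- j)
  sign[i+j]≈sign[i-j] i j = begin
    sign F (i ℤ.+ j)             ≈⟨ sign-+ i j ⟩
    sign F i * sign F j          ≈⟨ *-congˡ (sign-neg j) ⟨
    sign F i * sign F (ℤ.- j)    ≈⟨ sign-+ i (ℤ.- j) ⟨
    sign F (i ℤ.- j)             ∎

  module _ {t u : ℤ → Carrier} where

    IsGenFib-resp : (∀ n → t n ≈ u n) → IsGenFib F t → IsGenFib F u
    IsGenFib-resp t≈u t-fib n =
      trans (sym (t≈u _)) (trans (t-fib n) (+-cong (t≈u _) (t≈u n)))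

    IsGenFib-+ : IsGenFib F t → IsGenFib F u → IsGenFib F (λ n → t n + u n)
    IsGenFib-+ t-fib u-fib n = trans (+-cong (t-fib n) (u-fib n)) (interchange _ _ _ _)

    IsGenFib-unique : IsGenFib F t → IsGenFib F u → t 0ℤ ≈ u 0ℤ → t 1ℤ ≈ u 1ℤ → ∀ n → t n ≈ u n
    IsGenFib-unique t-fib u-fib t₀≈u₀ t₁≈u₁ n = proj₁ (ℤ-induction Agree (t₀≈u₀ , t₁≈u₁) up down n)
      where
      Agree : ℤ → Set ℓ
      Agree i = t i ≈ u i × t (i ℤ.+ 1ℤ) ≈ u (i ℤ.+ 1ℤ)
      next : ∀ {v} → IsGenFib F v → ∀ i → v (i ℤ.+ 1ℤ ℤ.+ 1ℤ) ≈ v (i ℤ.+ 1ℤ) + v i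
      next {v} v-fib i = trans (reindex v (ℤ.+-assoc i 1ℤ 1ℤ)) (v-fib i)
      up : ∀ i → Agree i → Agree (i ℤ.+ 1ℤ)
      up i (tᵢ≈uᵢ , tᵢ₊₁≈uᵢ₊₁) =
        tᵢ₊₁≈uᵢ₊₁ , trans (next t-fib i) (trans (+-cong tᵢ₊₁≈uᵢ₊₁ tᵢ≈uᵢ) (sym (next u-fib i)))
      down : ∀ i → Agree (i ℤ.+ 1ℤ) → Agree i
      down i (tᵢ₊₁≈uᵢ₊₁ , tᵢ₊₂≈uᵢ₊₂) = +-cancelˡ (u (i ℤ.+ 1ℤ)) (t i) (u i) (begin
        u (i ℤ.+ 1ℤ) + t i   ≈⟨ +-congʳ tᵢ₊₁≈uᵢ₊₁ ⟨
        t (i ℤ.+ 1ℤ) + t i   ≈⟨ next t-fib i ⟨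
        t (i ℤ.+ 1ℤ ℤ.+ 1ℤ)  ≈⟨ tᵢ₊₂≈uᵢ₊₂ ⟩
        u (i ℤ.+ 1ℤ ℤ.+ 1ℤ)  ≈⟨ next u-fib i ⟩
        u (i ℤ.+ 1ℤ) + u i   ∎) , tᵢ₊₁≈uᵢ₊₁

  module _ {t : ℤ → Carrier} (t-fib : IsGenFib F t) where

    IsGenFib-neg : IsGenFib F (λ n → - t n)
    IsGenFib-neg n = trans (-‿cong (t-fib n)) (sym (-‿+-comm _ _))

    IsGenFib-*ˡ : ∀ h → IsGenFib F (λ n → h * t n)
    IsGenFib-*ˡ h n = trans (*-congˡ (t-fib n)) (distribˡ h _ _)

    IsGenFib-*ʳ : ∀ h → IsGenFib F (λ n → t n * h)
    IsGenFib-*ʳ h n = trans (*-congʳ (t-fib n)) (distribʳ h _ _)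

    IsGenFib-shiftʳ : ∀ i → IsGenFib F (λ n → t (n ℤ.+ i))
    IsGenFib-shiftʳ i n = begin
      t (n ℤ.+ + 2 ℤ.+ i)                  ≡⟨ ≡.cong t (solveℤ (i ∷ n ∷ [])) ⟩
      t (n ℤ.+ i ℤ.+ + 2)                  ≈⟨ t-fib (n ℤ.+ i) ⟩
      t (n ℤ.+ i ℤ.+ + 1) + t (n ℤ.+ i)    ≡⟨ ≡.cong (λ k → t k + t (n ℤ.+ i)) (solveℤ (i ∷ n ∷ [])) ⟩
      t (n ℤ.+ + 1 ℤ.+ i) + t (n ℤ.+ i)    ∎

    IsGenFib-shiftˡ : ∀ i → IsGenFib F (λ n → t (i ℤ.+ n))
    IsGenFib-shiftˡ i = IsGenFib-resp (λ n → reindex t (ℤ.+-comm n i)) (IsGenFib-shiftʳ i)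

    IsGenFib-suc : ∀ i → t (i ℤ.+ 1ℤ) ≈ t i + t (i ℤ.- 1ℤ)
    IsGenFib-suc i = begin
      t (i ℤ.+ 1ℤ)                                  ≡⟨ ≡.cong t (solveℤ (i ∷ [])) ⟩
      t (i ℤ.- 1ℤ ℤ.+ + 2)                          ≈⟨ t-fib (i ℤ.- 1ℤ) ⟩
      t (i ℤ.- 1ℤ ℤ.+ + 1) + t (i ℤ.- 1ℤ)           ≡⟨ ≡.cong (λ k → t k + t (i ℤ.- 1ℤ)) (solveℤ (i ∷ [])) ⟩
      t i + t (i ℤ.- 1ℤ)                            ∎

    IsGenFib-suc² : ∀ i → t (i ℤ.+ 1ℤ ℤ.+ 1ℤ) ≈ (t i + t (i ℤ.- 1ℤ)) + t i
    IsGenFib-suc² i = begin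
      t (i ℤ.+ 1ℤ ℤ.+ 1ℤ)                           ≈⟨ IsGenFib-suc (i ℤ.+ 1ℤ) ⟩
      t (i ℤ.+ 1ℤ) + t (i ℤ.+ 1ℤ ℤ.- 1ℤ)            ≡⟨ ≡.cong (λ k → t (i ℤ.+ 1ℤ) + t k) (solveℤ (i ∷ [])) ⟩
      t (i ℤ.+ 1ℤ) + t i                            ≈⟨ +-congʳ (IsGenFib-suc i) ⟩
      (t i + t (i ℤ.- 1ℤ)) + t i                    ∎

    IsGenFib-reflect : ∀ i → IsGenFib F (λ n → sign F n * t (i ℤ.- n))
    IsGenFib-reflect i n = begin
      sign F (n ℤ.+ + 2) * t (i ℤ.- (n ℤ.+ + 2))
        ≈⟨ *-congʳ sign₂ ⟩
      s * z
        ≈⟨ solve 3 (λ s y z → s :* z := :- s :* y :+ s :* (y :+ z)) refl s y z ⟩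
      - s * y + s * (y + z)
        ≈⟨ +-cong (*-congʳ (sign-suc n)) (*-congˡ backwards) ⟨
      sign F (n ℤ.+ + 1) * y + s * t (i ℤ.- n)
        ∎
      where
      s y z : Carrier
      s = sign F n
      y = t (i ℤ.- (n ℤ.+ + 1))
      z = t (i ℤ.- (n ℤ.+ + 2))
      sign₂ : sign F (n ℤ.+ + 2) ≈ s
      sign₂ = begin
        sign F (n ℤ.+ + 2)             ≡⟨ ≡.cong (sign F) (ℤ.+-assoc n 1ℤ 1ℤ) ⟨
        sign F (n ℤ.+ 1ℤ ℤ.+ 1ℤ)       ≈⟨ sign-suc (n ℤ.+ 1ℤ) ⟩
        - sign F (n ℤ.+ 1ℤ)            ≈⟨ -‿cong (sign-suc n) ⟩
        - - s                          ≈⟨ -‿involutive s ⟩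
        s                              ∎
      backwards : t (i ℤ.- n) ≈ y + z
      backwards = begin
        t (i ℤ.- n)                                   ≡⟨ ≡.cong t (solveℤ (i ∷ n ∷ [])) ⟩
        t (i ℤ.- (n ℤ.+ + 2) ℤ.+ + 2)                 ≈⟨ t-fib (i ℤ.- (n ℤ.+ + 2)) ⟩
        t (i ℤ.- (n ℤ.+ + 2) ℤ.+ + 1) + z             ≡⟨ ≡.cong (λ k → t k + z) (solveℤ (i ∷ n ∷ [])) ⟩
        y + z                                         ∎

  IsGenFib-lucas : IsGenFib F (λ n → fromℤ F (Lucas n))
  IsGenFib-lucas n = trans (reflexive (≡.cong (fromℤ F) (lucas-recurrence n)))
                             (fromℤ-+ (Lucas (n ℤ.+ + 1)) (Lucas n))

  lucas-identity : ∀ {t} → IsGenFib F t → ∀ N k →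
                   t (N ℤ.+ k) + sign F k * t (N ℤ.- k) ≈ fromℤ F (Lucas k) * t N
  lucas-identity {t} t-fib N = IsGenFib-unique
    (IsGenFib-+ (IsGenFib-shiftˡ t-fib N) (IsGenFib-reflect t-fib N))
    (IsGenFib-*ʳ IsGenFib-lucas (t N))
    at-0 at-1
    where
    at-0 : t (N ℤ.+ 0ℤ) + 1# * t (N ℤ.+ 0ℤ) ≈ fromℕ 2 * t N
    at-0 = begin
      t (N ℤ.+ 0ℤ) + 1# * t (N ℤ.+ 0ℤ)   ≡⟨ ≡.cong (λ k → t k + 1# * t k) (ℤ.+-identityʳ N) ⟩
      t N + 1# * t N                     ≈⟨ solve 1 (λ y → y :+ con (+ 1) :* y := con (+ 2) :* y) refl (t N) ⟩
      fromℕ 2 * t N                      ∎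
    at-1 : t (N ℤ.+ 1ℤ) + (- 1# * 1#) * t (N ℤ.- 1ℤ) ≈ fromℕ 1 * t N
    at-1 = begin
      t (N ℤ.+ 1ℤ) + (- 1# * 1#) * t (N ℤ.- 1ℤ)
        ≈⟨ +-congʳ (IsGenFib-suc t-fib N) ⟩
      (t N + t (N ℤ.- 1ℤ)) + (- 1# * 1#) * t (N ℤ.- 1ℤ)
        ≈⟨ solve 2 (λ y z → (y :+ z) :+ (:- con (+ 1) :* con (+ 1)) :* z := con (+ 1) :* y)
                   refl (t N) (t (N ℤ.- 1ℤ)) ⟩
      1# * t N
        ≈⟨ *-congʳ (+-identityʳ 1#) ⟨
      fromℕ 1 * t N
        ∎

  recurrence⇒telescoping-step : ∀ {σ L x t₋ t₀ t₊} → t₊ + σ * t₋ ≈ L * t₀ →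
    t₀ + (- σ * x) * t₋ ≈ x * (t₊ + (- σ * x) * t₀) + (1# - L * x + σ * (x * x)) * t₀
  recurrence⇒telescoping-step {σ} {L} {x} {t₋} {t₀} {t₊} recurrence = begin
    t₀ + (- σ * x) * t₋
      ≈⟨ solve 5 (λ σ L x t₋ t₀ →
           t₀ :+ (:- σ :* x) :* t₋
           := x :* ((L :* t₀ :- σ :* t₋) :+ (:- σ :* x) :* t₀)
              :+ (con (+ 1) :- L :* x :+ σ :* (x :* x)) :* t₀) refl σ L x t₋ t₀ ⟩
    x * ((L * t₀ - σ * t₋) + (- σ * x) * t₀) + (1# - L * x + σ * (x * x)) * t₀
      ≈⟨ +-congʳ (*-congˡ (+-congʳ t₊≈Lt₀-σt₋)) ⟨
    x * (t₊ + (- σ * x) * t₀) + (1# - L * x + σ * (x * x)) * t₀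
      ∎
    where
    t₊≈Lt₀-σt₋ : t₊ ≈ L * t₀ - σ * t₋
    t₊≈Lt₀-σt₋ = begin
      t₊                       ≈⟨ solve 2 (λ u v → u := (u :+ v) :- v) refl t₊ (σ * t₋) ⟩
      (t₊ + σ * t₋) - σ * t₋   ≈⟨ +-congʳ recurrence ⟩
      L * t₀ - σ * t₋          ∎

  telescoping-sum : ∀ x (q f : ℕ → Carrier) → (∀ k → q k ≈ x * q (suc k) + f k) → ∀ n →
                    sumTo F n (λ k → pow F x k * f k) ≈ - (pow F x (suc n) * q (suc n)) + q 0
  telescoping-sum x q f step zero = begin
    1# * f 0
      ≈⟨ solve 3 (λ x q f → con (+ 1) :* f := :- ((x :* con (+ 1)) :* q) :+ (x :* q :+ f)) refl x (q 1) (f 0) ⟩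
    - ((x * 1#) * q 1) + (x * q 1 + f 0)
      ≈⟨ +-congˡ (step 0) ⟨
    - ((x * 1#) * q 1) + q 0
      ∎
  telescoping-sum x q f step (suc n) = begin
    sumTo F n (λ k → pow F x k * f k) + X * f (suc n)
      ≈⟨ +-congʳ (telescoping-sum x q f step n) ⟩
    (- (X * q (suc n)) + q 0) + X * f (suc n)
      ≈⟨ +-congʳ (+-congʳ (-‿cong (*-congˡ (step (suc n))))) ⟩
    (- (X * (x * q (suc (suc n)) + f (suc n))) + q 0) + X * f (suc n)
      ≈⟨ solve 5 (λ X x q₂ f₁ q₀ → (:- (X :* (x :* q₂ :+ f₁)) :+ q₀) :+ X :* f₁ := :- ((x :* X) :* q₂) :+ q₀)
                 refl X x (q (suc (suc n))) (f (suc n)) (q 0) ⟩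
    - ((x * X) * q (suc (suc n))) + q 0
      ∎
    where
    X : Carrier
    X = pow F x (suc n)

  sumTo-cong : ∀ {f f′ : ℕ → Carrier} → (∀ k → f k ≈ f′ k) → ∀ n → sumTo F n f ≈ sumTo F n f′
  sumTo-cong f≈f′ zero    = f≈f′ 0
  sumTo-cong f≈f′ (suc n) = +-cong (sumTo-cong f≈f′ n) (f≈f′ (suc n))

  module FibonacciProducts {G H : ℤ → Carrier} (G-fib : IsGenFib F G) (H-fib : IsGenFib F H) where

    g : ℤ → ℤ → Carrier
    g A C = G A * H C

    diag : ℤ → ℤ → Carrier
    diag A C = g (A ℤ.- 1ℤ) (C ℤ.- 1ℤ) + g (A ℤ.+ 1ℤ) (C ℤ.+ 1ℤ)

    -- In Binet form g A C is a combination of the terms ρ^A τ^C with ρ, τ ∈ {φ, ψ}, on which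
    -- diag acts as multiplication by (ρτ)⁻¹ + ρτ: by 3 if ρ = τ and by -2 if ρ ≠ τ.  Hence
    -- sameRoot is 5 times the ρ = τ part of g, a function of A + C, and mixedRoot is 5 times
    -- the ρ ≠ τ part, which changes sign when A and C both increase by 1 (as φψ = -1).
    sameRoot : ℤ → ℤ → Carrier
    sameRoot A C = fromℕ 2 * g A C + diag A C

    mixedRoot : ℤ → ℤ → Carrier
    mixedRoot A C = fromℕ 3 * g A C - diag A C

    sameRoot+mixedRoot : ∀ A C → sameRoot A C + mixedRoot A C ≈ fromℕ 5 * g A C
    sameRoot+mixedRoot A C =
      solve 2 (λ g d → (con (+ 2) :* g :+ d) :+ (con (+ 3) :* g :- d) := con (+ 5) :* g) refl (g A C) (diag A C)

    g-fibˡ : ∀ C → IsGenFib F (λ A → g A C)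
    g-fibˡ C = IsGenFib-*ʳ G-fib (H C)

    g-fibʳ : ∀ A → IsGenFib F (g A)
    g-fibʳ A = IsGenFib-*ˡ H-fib (G A)

    diag-fibˡ : ∀ C → IsGenFib F (λ A → diag A C)
    diag-fibˡ C = IsGenFib-+ (IsGenFib-shiftʳ (g-fibˡ (C ℤ.- 1ℤ)) (ℤ.- 1ℤ))
                             (IsGenFib-shiftʳ (g-fibˡ (C ℤ.+ 1ℤ)) 1ℤ)

    diag-fibʳ : ∀ A → IsGenFib F (diag A)
    diag-fibʳ A = IsGenFib-+ (IsGenFib-shiftʳ (g-fibʳ (A ℤ.- 1ℤ)) (ℤ.- 1ℤ))
                             (IsGenFib-shiftʳ (g-fibʳ (A ℤ.+ 1ℤ)) 1ℤ)

    sameRoot-fibˡ : ∀ C → IsGenFib F (λ A → sameRoot A C)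
    sameRoot-fibˡ C = IsGenFib-+ (IsGenFib-*ˡ (g-fibˡ C) (fromℕ 2)) (diag-fibˡ C)

    sameRoot-fibʳ : ∀ A → IsGenFib F (sameRoot A)
    sameRoot-fibʳ A = IsGenFib-+ (IsGenFib-*ˡ (g-fibʳ A) (fromℕ 2)) (diag-fibʳ A)

    mixedRoot-fibˡ : ∀ C → IsGenFib F (λ A → mixedRoot A C)
    mixedRoot-fibˡ C = IsGenFib-+ (IsGenFib-*ˡ (g-fibˡ C) (fromℕ 3)) (IsGenFib-neg (diag-fibˡ C))

    mixedRoot-fibʳ : ∀ A → IsGenFib F (mixedRoot A)
    mixedRoot-fibʳ A = IsGenFib-+ (IsGenFib-*ˡ (g-fibʳ A) (fromℕ 3)) (IsGenFib-neg (diag-fibʳ A))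

    module _ (A C : ℤ) where
      private
        a₀ a₁ h₀ h₁ : Carrier
        a₀ = G (A ℤ.- 1ℤ)
        a₁ = G A
        h₀ = H (C ℤ.- 1ℤ)
        h₁ = H C
        G₊₁ : G (A ℤ.+ 1ℤ) ≈ a₁ + a₀
        G₊₁ = IsGenFib-suc G-fib A
        G₊₂ : G (A ℤ.+ 1ℤ ℤ.+ 1ℤ) ≈ (a₁ + a₀) + a₁
        G₊₂ = IsGenFib-suc² G-fib A
        H₊₁ : H (C ℤ.+ 1ℤ) ≈ h₁ + h₀
        H₊₁ = IsGenFib-suc H-fib C
        H₊₂ : H (C ℤ.+ 1ℤ ℤ.+ 1ℤ) ≈ (h₁ + h₀) + h₁
        H₊₂ = IsGenFib-suc² H-fib C

      sameRoot-slide : sameRoot (A ℤ.+ 1ℤ) C ≈ sameRoot A (C ℤ.+ 1ℤ)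
      sameRoot-slide = begin
        fromℕ 2 * (G (A ℤ.+ 1ℤ) * h₁) + (G (A ℤ.+ 1ℤ ℤ.- 1ℤ) * h₀ + G (A ℤ.+ 1ℤ ℤ.+ 1ℤ) * H (C ℤ.+ 1ℤ))
          ≈⟨ +-cong (*-congˡ (*-congʳ G₊₁)) (+-cong (*-congʳ (reindex G ([i+1]-1≡i A))) (*-cong G₊₂ H₊₁)) ⟩
        fromℕ 2 * ((a₁ + a₀) * h₁) + (a₁ * h₀ + ((a₁ + a₀) + a₁) * (h₁ + h₀))
          ≈⟨ solve 4 (λ a₀ a₁ h₀ h₁ →
               con (+ 2) :* ((a₁ :+ a₀) :* h₁) :+ (a₁ :* h₀ :+ ((a₁ :+ a₀) :+ a₁) :* (h₁ :+ h₀))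
               := con (+ 2) :* (a₁ :* (h₁ :+ h₀)) :+ (a₀ :* h₁ :+ (a₁ :+ a₀) :* ((h₁ :+ h₀) :+ h₁)))
               refl a₀ a₁ h₀ h₁ ⟩
        fromℕ 2 * (a₁ * (h₁ + h₀)) + (a₀ * h₁ + (a₁ + a₀) * ((h₁ + h₀) + h₁))
          ≈⟨ +-cong (*-congˡ (*-congˡ H₊₁)) (+-cong (*-congˡ (reindex H ([i+1]-1≡i C))) (*-cong G₊₁ H₊₂)) ⟨
        fromℕ 2 * (a₁ * H (C ℤ.+ 1ℤ)) + (a₀ * H (C ℤ.+ 1ℤ ℤ.- 1ℤ) + G (A ℤ.+ 1ℤ) * H (C ℤ.+ 1ℤ ℤ.+ 1ℤ))
          ∎

      mixedRoot-slide : mixedRoot (A ℤ.+ 1ℤ) (C ℤ.+ 1ℤ) ≈ - mixedRoot A C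
      mixedRoot-slide = begin
        fromℕ 3 * (G (A ℤ.+ 1ℤ) * H (C ℤ.+ 1ℤ))
          - (G (A ℤ.+ 1ℤ ℤ.- 1ℤ) * H (C ℤ.+ 1ℤ ℤ.- 1ℤ) + G (A ℤ.+ 1ℤ ℤ.+ 1ℤ) * H (C ℤ.+ 1ℤ ℤ.+ 1ℤ))
          ≈⟨ +-cong (*-congˡ (*-cong G₊₁ H₊₁))
                    (-‿cong (+-cong (*-cong (reindex G ([i+1]-1≡i A)) (reindex H ([i+1]-1≡i C)))
                                    (*-cong G₊₂ H₊₂))) ⟩
        fromℕ 3 * ((a₁ + a₀) * (h₁ + h₀)) - (a₁ * h₁ + ((a₁ + a₀) + a₁) * ((h₁ + h₀) + h₁))
          ≈⟨ solve 4 (λ a₀ a₁ h₀ h₁ →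
               con (+ 3) :* ((a₁ :+ a₀) :* (h₁ :+ h₀)) :- (a₁ :* h₁ :+ ((a₁ :+ a₀) :+ a₁) :* ((h₁ :+ h₀) :+ h₁))
               := :- (con (+ 3) :* (a₁ :* h₁) :- (a₀ :* h₀ :+ (a₁ :+ a₀) :* (h₁ :+ h₀))))
               refl a₀ a₁ h₀ h₁ ⟩
        - (fromℕ 3 * (a₁ * h₁) - (a₀ * h₀ + (a₁ + a₀) * (h₁ + h₀)))
          ≈⟨ -‿cong (+-congˡ (-‿cong (+-congˡ (*-cong G₊₁ H₊₁)))) ⟨
        - mixedRoot A C
          ∎

    sameRoot-transfer : ∀ A C k → sameRoot A (C ℤ.+ k) ≈ sameRoot (A ℤ.+ k) C
    sameRoot-transfer A C = IsGenFib-unique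
      (IsGenFib-shiftˡ (sameRoot-fibʳ A) C) (IsGenFib-shiftˡ (sameRoot-fibˡ C) A)
      (reindex₂ sameRoot (≡.sym (ℤ.+-identityʳ A)) (ℤ.+-identityʳ C))
      (sym (sameRoot-slide A C))

    mixedRoot-transfer : ∀ A C k → mixedRoot A (C ℤ.+ k) ≈ sign F k * mixedRoot (A ℤ.- k) C
    mixedRoot-transfer A C = IsGenFib-unique
      (IsGenFib-shiftˡ (mixedRoot-fibʳ A) C) (IsGenFib-reflect (mixedRoot-fibˡ C) A)
      (trans (reindex₂ mixedRoot (≡.sym (ℤ.+-identityʳ A)) (ℤ.+-identityʳ C)) (sym (*-identityˡ _)))
      (begin
        mixedRoot A (C ℤ.+ 1ℤ)                       ≈⟨ reindex₂ mixedRoot ([i-1]+1≡i A) ≡.refl ⟨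
        mixedRoot (A ℤ.- 1ℤ ℤ.+ 1ℤ) (C ℤ.+ 1ℤ)        ≈⟨ mixedRoot-slide (A ℤ.- 1ℤ) C ⟩
        - mixedRoot (A ℤ.- 1ℤ) C                     ≈⟨ -1*x≈-x _ ⟨
        - 1# * mixedRoot (A ℤ.- 1ℤ) C                ≈⟨ *-congʳ (*-identityʳ (- 1#)) ⟨
        (- 1# * 1#) * mixedRoot (A ℤ.- 1ℤ) C         ∎)

    sameRoot-recurrence : ∀ b d A C →
      sameRoot (A ℤ.+ b) (C ℤ.+ d) + sign F (b ℤ.+ d) * sameRoot (A ℤ.- b) (C ℤ.- d)
        ≈ fromℤ F (Lucas (b ℤ.+ d)) * sameRoot A C
    sameRoot-recurrence b d A C = begin
      sameRoot (A ℤ.+ b) (C ℤ.+ d) + σ * sameRoot (A ℤ.- b) (C ℤ.- d)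
        ≈⟨ +-cong (sameRoot-transfer (A ℤ.+ b) C d) (*-congˡ (sameRoot-transfer (A ℤ.- b) C (ℤ.- d))) ⟩
      sameRoot (A ℤ.+ b ℤ.+ d) C + σ * sameRoot (A ℤ.- b ℤ.- d) C
        ≡⟨ ≡.cong₂ (λ i j → sameRoot i C + σ * sameRoot j C) (solveℤ (b ∷ d ∷ A ∷ [])) (solveℤ (b ∷ d ∷ A ∷ [])) ⟩
      sameRoot (A ℤ.+ (b ℤ.+ d)) C + σ * sameRoot (A ℤ.- (b ℤ.+ d)) C
        ≈⟨ lucas-identity (sameRoot-fibˡ C) A (b ℤ.+ d) ⟩
      fromℤ F (Lucas (b ℤ.+ d)) * sameRoot A C
        ∎
      where
      σ : Carrier
      σ = sign F (b ℤ.+ d)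

    mixedRoot-recurrence : ∀ b d A C →
      mixedRoot (A ℤ.+ b) (C ℤ.+ d) + sign F (b ℤ.+ d) * mixedRoot (A ℤ.- b) (C ℤ.- d)
        ≈ (sign F d * fromℤ F (Lucas (b ℤ.- d))) * mixedRoot A C
    mixedRoot-recurrence b d A C = begin
      mixedRoot (A ℤ.+ b) (C ℤ.+ d) + sign F (b ℤ.+ d) * mixedRoot (A ℤ.- b) (C ℤ.- d)
        ≈⟨ +-cong (mixedRoot-transfer (A ℤ.+ b) C d)
                  (*-cong (sign[i+j]≈sign[i-j] b d) (mixedRoot-transfer (A ℤ.- b) C (ℤ.- d))) ⟩
      s * mixedRoot (A ℤ.+ b ℤ.- d) C + σ * (sign F (ℤ.- d) * mixedRoot (A ℤ.- b ℤ.- ℤ.- d) C)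
        ≡⟨ ≡.cong₂ (λ i j → s * mixedRoot i C + σ * (sign F (ℤ.- d) * mixedRoot j C))
                   (solveℤ (b ∷ d ∷ A ∷ [])) (solveℤ (b ∷ d ∷ A ∷ [])) ⟩
      s * u₊ + σ * (sign F (ℤ.- d) * u₋)
        ≈⟨ +-congˡ (*-congˡ (*-congʳ (sign-neg d))) ⟩
      s * u₊ + σ * (s * u₋)
        ≈⟨ solve 4 (λ s σ u₊ u₋ → s :* u₊ :+ σ :* (s :* u₋) := s :* (u₊ :+ σ :* u₋)) refl s σ u₊ u₋ ⟩
      s * (u₊ + σ * u₋)
        ≈⟨ *-congˡ (lucas-identity (mixedRoot-fibˡ C) A (b ℤ.- d)) ⟩
      s * (fromℤ F (Lucas (b ℤ.- d)) * mixedRoot A C)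
        ≈⟨ *-assoc _ _ _ ⟨
      (s * fromℤ F (Lucas (b ℤ.- d))) * mixedRoot A C
        ∎
      where
      s σ u₊ u₋ : Carrier
      s  = sign F d
      σ  = sign F (b ℤ.- d)
      u₊ = mixedRoot (A ℤ.+ (b ℤ.- d)) C
      u₋ = mixedRoot (A ℤ.- (b ℤ.- d)) C

    P₂-one : ∀ a b c d x w →
      P₂ F G H a b c d x 1 w
        ≈ g (a ℤ.+ b ℤ.* w) (c ℤ.+ d ℤ.* w)
          + (- sign F (b ℤ.+ d) * x) * g (a ℤ.+ b ℤ.* w ℤ.- b) (c ℤ.+ d ℤ.* w ℤ.- d)
    P₂-one a b c d x w = +-cong term₀ term₁
      where
      A C : ℤ
      A = a ℤ.+ b ℤ.* w
      C = c ℤ.+ d ℤ.* w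
      σ : Carrier
      σ = sign F (b ℤ.+ d)
      term₀ : fromℕ 1 * sign F ((b ℤ.+ d ℤ.+ 1ℤ) ℤ.* 0ℤ) * 1# * G (A ℤ.- b ℤ.* 0ℤ) * H (C ℤ.- d ℤ.* 0ℤ)
              ≈ g A C
      term₀ = begin
        fromℕ 1 * sign F ((b ℤ.+ d ℤ.+ 1ℤ) ℤ.* 0ℤ) * 1# * G (A ℤ.- b ℤ.* 0ℤ) * H (C ℤ.- d ℤ.* 0ℤ)
          ≈⟨ *-cong (*-cong (*-congʳ (*-congˡ (reindex (sign F) (ℤ.*-zeroʳ (b ℤ.+ d ℤ.+ 1ℤ)))))
                            (reindex G (i-j*0≡i A b)))
                    (reindex H (i-j*0≡i C d)) ⟩
        fromℕ 1 * 1# * 1# * G A * H C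
          ≈⟨ solve 2 (λ y z → (con (+ 1) :+ con (+ 0)) :* con (+ 1) :* con (+ 1) :* y :* z := y :* z)
                     refl (G A) (H C) ⟩
        G A * H C
          ∎
      term₁ : fromℕ 1 * sign F ((b ℤ.+ d ℤ.+ 1ℤ) ℤ.* 1ℤ) * (x * 1#) * G (A ℤ.- b ℤ.* 1ℤ) * H (C ℤ.- d ℤ.* 1ℤ)
              ≈ (- σ * x) * g (A ℤ.- b) (C ℤ.- d)
      term₁ = begin
        fromℕ 1 * sign F ((b ℤ.+ d ℤ.+ 1ℤ) ℤ.* 1ℤ) * (x * 1#) * G (A ℤ.- b ℤ.* 1ℤ) * H (C ℤ.- d ℤ.* 1ℤ)
          ≈⟨ *-cong (*-cong (*-congʳ (*-congˡ (trans (reindex (sign F) (ℤ.*-identityʳ (b ℤ.+ d ℤ.+ 1ℤ)))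
                                                      (sign-suc (b ℤ.+ d)))))
                            (reindex G (i-j*1≡i-j A b)))
                    (reindex H (i-j*1≡i-j C d)) ⟩
        fromℕ 1 * - σ * (x * 1#) * G (A ℤ.- b) * H (C ℤ.- d)
          ≈⟨ solve 4 (λ σ x y z → (con (+ 1) :+ con (+ 0)) :* :- σ :* (x :* con (+ 1)) :* y :* z
                                  := (:- σ :* x) :* (y :* z))
                     refl σ x (G (A ℤ.- b)) (H (C ℤ.- d)) ⟩
        (- σ * x) * (G (A ℤ.- b) * H (C ℤ.- d))
          ∎

    module Telescope (a b c d : ℤ) (x : Carrier)
                     (nz₁ : ¬ (Δ₁ F b d x ≈ 0#)) (nz₂ : ¬ (Δ₂ F b d x ≈ 0#)) where

      σ : Carrier
      σ = sign F (b ℤ.+ d)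

      A C : ℤ → ℤ
      A w = a ℤ.+ b ℤ.* w
      C w = c ℤ.+ d ℤ.* w

      i₁ i₂ i₅ : Carrier
      i₁ = inv F (Δ₁ F b d x) nz₁
      i₂ = inv F (Δ₂ F b d x) nz₂
      i₅ = inv F (fromℕ 5) (char0 4)

      Q : ℤ → Carrier
      Q = Q₂ F G H a b c d x i₁ i₂ i₅ 1

      pairing : (ℤ → ℤ → Carrier) → ℤ → Carrier
      pairing u w = u (A w) (C w) + (- σ * x) * u (A w ℤ.- b) (C w ℤ.- d)

      P₂-shift : ∀ e w → P₂ F G H (a ℤ.+ e) b (c ℤ.+ e) d x 1 w
                         ≈ g (A w ℤ.+ e) (C w ℤ.+ e) + (- σ * x) * g (A w ℤ.- b ℤ.+ e) (C w ℤ.- d ℤ.+ e)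
      P₂-shift e w = trans (P₂-one (a ℤ.+ e) b (c ℤ.+ e) d x w)
        (+-cong (reindex₂ g ([i+e]+j*w≡[i+j*w]+e a e b w) ([i+e]+j*w≡[i+j*w]+e c e d w))
                (*-congˡ (reindex₂ g ([i+e]+j*w-j≡[i+j*w-j]+e a e b w) ([i+e]+j*w-j≡[i+j*w-j]+e c e d w))))

      Q-expansion : ∀ w → Q w ≈ i₅ * (i₁ * pairing sameRoot w + i₂ * pairing mixedRoot w)
      Q-expansion w = trans
        (*-congˡ (+-cong (*-congˡ (P₂-one a b c d x w))
                         (*-congˡ (+-cong (P₂-shift (ℤ.- 1ℤ) w) (P₂-shift 1ℤ w)))))
        (solve 10 (λ i₁ i₂ i₅ k g₀ g₋ g₊ h₀ h₋ h₊ →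
           i₅ :* ((con (+ 2) :* (i₁ :* con (+ 1)) :+ con (+ 3) :* (i₂ :* con (+ 1))) :* (g₀ :+ k :* h₀)
                  :+ (i₁ :* con (+ 1) :- i₂ :* con (+ 1)) :* ((g₋ :+ k :* h₋) :+ (g₊ :+ k :* h₊)))
           := i₅ :* (i₁ :* ((con (+ 2) :* g₀ :+ (g₋ :+ g₊)) :+ k :* (con (+ 2) :* h₀ :+ (h₋ :+ h₊)))
                     :+ i₂ :* ((con (+ 3) :* g₀ :- (g₋ :+ g₊)) :+ k :* (con (+ 3) :* h₀ :- (h₋ :+ h₊)))))
           refl i₁ i₂ i₅ (- σ * x)
           (g (A w) (C w)) (g (A w ℤ.- 1ℤ) (C w ℤ.- 1ℤ)) (g (A w ℤ.+ 1ℤ) (C w ℤ.+ 1ℤ))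
           (g (A w ℤ.- b) (C w ℤ.- d)) (g (A w ℤ.- b ℤ.- 1ℤ) (C w ℤ.- d ℤ.- 1ℤ))
           (g (A w ℤ.- b ℤ.+ 1ℤ) (C w ℤ.- d ℤ.+ 1ℤ)))

      pairing-suc : ∀ u w → pairing u (w ℤ.+ 1ℤ) ≈ u (A w ℤ.+ b) (C w ℤ.+ d) + (- σ * x) * u (A w) (C w)
      pairing-suc u w = +-cong (reindex₂ u (i+j*[w+1]≡i+j*w+j a b w) (i+j*[w+1]≡i+j*w+j c d w))
                               (*-congˡ (reindex₂ u (i+j*[w+1]-j≡i+j*w a b w) (i+j*[w+1]-j≡i+j*w c d w)))

      pairing-step : ∀ {L} u → (∀ A C → u (A ℤ.+ b) (C ℤ.+ d) + σ * u (A ℤ.- b) (C ℤ.- d) ≈ L * u A C) →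
                     ∀ w → pairing u w ≈ x * pairing u (w ℤ.+ 1ℤ) + (1# - L * x + σ * (x * x)) * u (A w) (C w)
      pairing-step u recurrence w = trans (recurrence⇒telescoping-step (recurrence (A w) (C w)))
                                          (+-congʳ (*-congˡ (sym (pairing-suc u w))))

      Q-step : ∀ w → Q w ≈ x * Q (w ℤ.+ 1ℤ) + g (A w) (C w)
      Q-step w = begin
        Q w
          ≈⟨ Q-expansion w ⟩
        i₅ * (i₁ * pairing sameRoot w + i₂ * pairing mixedRoot w)
          ≈⟨ *-congˡ (+-cong (*-congˡ (pairing-step sameRoot (sameRoot-recurrence b d) w))
                             (*-congˡ (pairing-step mixedRoot (mixedRoot-recurrence b d) w))) ⟩
        i₅ * (i₁ * (x * T′ + Δ₁′ * T) + i₂ * (x * U′ + Δ₂′ * U))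
          ≈⟨ solve 10 (λ i₁ i₂ i₅ x T′ U′ T U Δ₁′ Δ₂′ →
               i₅ :* (i₁ :* (x :* T′ :+ Δ₁′ :* T) :+ i₂ :* (x :* U′ :+ Δ₂′ :* U))
               := x :* (i₅ :* (i₁ :* T′ :+ i₂ :* U′)) :+ i₅ :* ((Δ₁′ :* i₁) :* T :+ (Δ₂′ :* i₂) :* U))
               refl i₁ i₂ i₅ x T′ U′ T U Δ₁′ Δ₂′ ⟩
        x * (i₅ * (i₁ * T′ + i₂ * U′)) + i₅ * ((Δ₁′ * i₁) * T + (Δ₂′ * i₂) * U)
          ≈⟨ +-cong (*-congˡ (Q-expansion (w ℤ.+ 1ℤ)))
                    (*-congˡ (+-cong (*-congʳ (sym Δ₁′*i₁≈1)) (*-congʳ (sym Δ₂′*i₂≈1)))) ⟨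
        x * Q (w ℤ.+ 1ℤ) + i₅ * (1# * T + 1# * U)
          ≈⟨ +-congˡ (*-congˡ (trans (+-cong (*-identityˡ T) (*-identityˡ U))
                                     (sameRoot+mixedRoot (A w) (C w)))) ⟩
        x * Q (w ℤ.+ 1ℤ) + i₅ * (fromℕ 5 * g (A w) (C w))
          ≈⟨ +-congˡ (trans (sym (*-assoc _ _ _)) (*-congʳ (*-comm i₅ (fromℕ 5)))) ⟩
        x * Q (w ℤ.+ 1ℤ) + (fromℕ 5 * i₅) * g (A w) (C w)
          ≈⟨ +-congˡ (trans (*-congʳ (proj₂ (inverse (fromℕ 5) (char0 4)))) (*-identityˡ _)) ⟩
        x * Q (w ℤ.+ 1ℤ) + g (A w) (C w)
          ∎
        where
        T T′ U U′ Δ₁′ Δ₂′ : Carrier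
        T   = sameRoot (A w) (C w)
        T′  = pairing sameRoot (w ℤ.+ 1ℤ)
        U   = mixedRoot (A w) (C w)
        U′  = pairing mixedRoot (w ℤ.+ 1ℤ)
        Δ₁′ = Δ₁ F b d x
        Δ₂′ = 1# - sign F d * fromℤ F (Lucas (b ℤ.- d)) * x + σ * (x * x)
        Δ₁′*i₁≈1 : Δ₁′ * i₁ ≈ 1#
        Δ₁′*i₁≈1 = proj₂ (inverse (Δ₁ F b d x) nz₁)
        Δ₂′*i₂≈1 : Δ₂′ * i₂ ≈ 1#
        Δ₂′*i₂≈1 = trans (*-congʳ (+-congˡ (*-congʳ (sign[i+j]≈sign[i-j] b d))))
                         (proj₂ (inverse (Δ₂ F b d x) nz₂))

      Q-stepℕ : ∀ k → Q (+ k) ≈ x * Q (+ suc k) + G (A (+ k)) * H (C (+ k))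
      Q-stepℕ k = trans (Q-step (+ k)) (+-congʳ (*-congˡ (reindex Q (≡.cong +_ (ℕ.+-comm k 1)))))

mainTheorem1 : ∀ {c ℓ} (F : Char0Field c ℓ) →
    let open Char0Field F in
    (G H : ℤ → Carrier) → IsGenFib F G → IsGenFib F H →
    (a b c d : ℤ) (x : Carrier) →
    (nz₁ : ¬ (Δ₁ F b d x ≈ 0#)) → (nz₂ : ¬ (Δ₂ F b d x ≈ 0#)) →
    (n : ℕ) →
      sumTo F n (λ k → pow F x k * G (a Data.Integer.+ b Data.Integer.* + k) * H (c Data.Integer.+ d Data.Integer.* + k))
      ≈ (- (pow F x (suc n) * Q₂ F G H a b c d x (inv F _ nz₁) (inv F _ nz₂) (inv F (fromℕ 5) (char0 4)) 1 (+ suc n)))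
        + Q₂ F G H a b c d x (inv F _ nz₁) (inv F _ nz₂) (inv F (fromℕ 5) (char0 4)) 1 (+ 0)
mainTheorem1 F G H G-fib H-fib a b c d x nz₁ nz₂ n =
  trans (sumTo-cong F (λ k → *-assoc _ _ _) n)
        (telescoping-sum F x (λ k → Q (+ k)) (λ k → G (A (+ k)) * H (C (+ k))) Q-stepℕ n)
  where
  open Char0Field F using (_*_; *-assoc; trans)
  open FibonacciProducts.Telescope F G-fib H-fib a b c d x nz₁ nz₂ using (A; C; Q; Q-stepℕ)
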